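{- Let $\ell$ be a prime, $G$ a finite abelian group and $S\subseteq G$ with $S$ generating $G$, $S=S^{ -1}$, $1\notin S$. Let $\beta:S\to\mathbb{Z}_\ell$ satisfy: the image of $\beta$ generates $\mathbb{Z}_\ell$ as a $\mathbb{Z}_\ell$-module; $\beta(s^{ -1})=-\beta(s)$ for all $s\in S$; and $\beta(S)\subseteq\mathbb{Z}$. Suppose there exists $h\in S$ of order $M>1$ with $\gcd(M,\ell)=1$ and $\beta(h)\not\equiv0\pmod\ell$. Then there exist $m>0$ and $(h_1,\dots,h_m)\in S^m$ with $h_1h_2\cdots h_m\in S$ and \[\beta(h_1h_2\cdots h_m)\not\equiv\sum_{i=1}^m\beta(h_i)\pmod\ell.\] -}

module Defs where

open import Level using (Level; _⊔_)
open import Algebra.Bundles using (AbelianGroup)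
open import Data.Nat as ℕ using (ℕ; zero; suc)
open import Data.Fin using (Fin)
open import Data.List using (List; []; _∷_)
open import Data.List.Relation.Unary.All using (All)
open import Data.Vec using (Vec)
import Data.Vec as Vec
open import Data.Integer as ℤ using (ℤ)
open import Data.Integer.Divisibility using () renaming (_∣_ to _∣ℤ_)
open import Data.Product using (Σ; ∃; _×_)
open import Relation.Nullary using (¬_)

module _ {c r : Level} (G : AbelianGroup c r) where
  open AbelianGroup G

  pow : Carrier → ℕ → Carrier
  pow g zero    = ε
  pow g (suc n) = g ∙ pow g n

  prodL : List Carrier → Carrier
  prodL []       = ε
  prodL (x ∷ xs) = x ∙ prodL xs

  prodV : ∀ {m} → Vec Carrier m → Carrier
  prodV = Vec.foldr _ _∙_ ε

  IsFinite : Set (c ⊔ r)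
  IsFinite = ∃ λ (n : ℕ) → Σ (Fin n → Carrier) λ f → ∀ g → ∃ λ i → f i ≈ g

  Generates : ∀ {p} → (Carrier → Set p) → Set (c ⊔ r ⊔ p)
  Generates S = ∀ g → ∃ λ (ws : List Carrier) → All S ws × (prodL ws ≈ g)

  HasOrder : Carrier → ℕ → Set r
  HasOrder h M = (0 ℕ.< M) × (pow h M ≈ ε) × (∀ k → 0 ℕ.< k → k ℕ.< M → ¬ (pow h k ≈ ε))

sumβ : ∀ {a} {A : Set a} {m} → (A → ℤ) → Vec A m → ℤ
sumβ β = Vec.foldr _ (λ x acc → β x ℤ.+ acc) (ℤ.+ 0)

_≡_[modℕ_] : ℤ → ℤ → ℕ → Set
a ≡ b [modℕ ℓ ] = (ℤ.+ ℓ) ∣ℤ (a ℤ.- b)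

-- The image of β : S → ℤ ⊆ ℤ_ℓ generates ℤ_ℓ as a ℤ_ℓ-module.
-- Since ℤ_ℓ is local with maximal ideal ℓℤ_ℓ, for integer values this
-- literally means: some β(s), s ∈ S, is an ℓ-adic unit, i.e. ℓ ∤ β(s).
ImageGeneratesℤℓ : ∀ {c p} {A : Set c} → (A → Set p) → (A → ℤ) → ℕ → Set (c ⊔ p)
ImageGeneratesℤℓ S β ℓ = ∃ λ s → S s × ¬ (β s ≡ ℤ.+ 0 [modℕ ℓ ])

-- The word h h ⋯ h of length M − 1 multiplies to h⁻¹ ∈ S, so its defect
-- β(h⁻¹) − (M − 1)β(h) = −Mβ(h) is prime to ℓ, because ℓ divides neither M
-- (gcd M ℓ = 1) nor β(h).
module Submission where

open import Defs
open import Level using (Level)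
open import Algebra.Bundles using (AbelianGroup)
import Algebra.Properties.Group as GroupProperties
open import Data.Nat using (ℕ; zero; suc; _<_; s≤s; z≤n)
open import Data.Nat.Divisibility using (_∣_; _∤_; ∣-refl)
open import Data.Nat.Primality using (Prime; euclidsLemma; ¬prime[1])
open import Data.Nat.GCD using (gcd)
open import Data.Nat.Coprimality using (gcd≡1⇒coprime)
open import Data.Integer using (ℤ; +_; -_; _+_; _-_; _*_; ∣_∣)
open import Data.Integer.Properties
  using (∣-i∣≡∣i∣; abs-*; +-identityʳ; neg-distrib-+; suc-*)
open import Data.Integer.Divisibility using () renaming (_∣_ to _∣ℤ_)
open import Data.Vec using (Vec; replicate)
open import Data.Vec.Relation.Unary.All using (All; []; _∷_)
open import Data.Product using (Σ; ∃; _×_; _,_)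
open import Data.Sum using (inj₁; inj₂)
open import Relation.Nullary using (¬_)
open import Function using (_∘_)
open import Relation.Binary.PropositionalEquality
  using (_≡_; refl; sym; cong; cong₂; subst; module ≡-Reasoning)

module _ {c r : Level} (G : AbelianGroup c r) where
  open AbelianGroup G using (_≈_; ε; _⁻¹; ∙-congˡ; group)
    renaming (refl to ≈-refl; trans to ≈-trans)

  prodV-replicate : ∀ n h → prodV G (replicate n h) ≈ pow G h n
  prodV-replicate zero    h = ≈-refl
  prodV-replicate (suc n) h = ∙-congˡ (prodV-replicate n h)

  prodV-replicate≈⁻¹ : ∀ h n → pow G h (suc n) ≈ ε → prodV G (replicate n h) ≈ h ⁻¹
  prodV-replicate≈⁻¹ h n hⁿ⁺¹≈ε =
    ≈-trans (prodV-replicate n h) (GroupProperties.inverseʳ-unique group h (pow G h n) hⁿ⁺¹≈ε)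

All-replicate : ∀ {a p} {A : Set a} {P : A → Set p} n {x} → P x → All P (replicate n x)
All-replicate zero    px = []
All-replicate (suc n) px = px ∷ All-replicate n px

sumβ-replicate : ∀ {a} {A : Set a} (β : A → ℤ) n x → sumβ β (replicate n x) ≡ + n * β x
sumβ-replicate β zero    x = refl
sumβ-replicate β (suc n) x = begin
  β x + sumβ β (replicate n x) ≡⟨ cong (λ s → β x + s) (sumβ-replicate β n x) ⟩
  β x + + n * β x              ≡⟨ suc-* (+ n) (β x) ⟨
  + suc n * β x                ∎
  where open ≡-Reasoning

neg-sub-*≡neg-suc-* : ∀ n b → - b - + n * b ≡ - (+ suc n * b)
neg-sub-*≡neg-suc-* n b = begin
  - b - + n * b     ≡⟨ neg-distrib-+ b (+ n * b) ⟨
  - (b + + n * b)   ≡⟨ cong -_ (suc-* (+ n) b) ⟨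
  - (+ suc n * b)   ∎
  where open ≡-Reasoning

gcd≡1∧prime⇒∤ : ∀ m {p} → Prime p → gcd m p ≡ 1 → p ∤ m
gcd≡1∧prime⇒∤ _ pp gcd≡1 p∣m with gcd≡1⇒coprime gcd≡1 (p∣m , ∣-refl)
... | refl = ¬prime[1] pp

prime∤*ℤ : ∀ {p} → Prime p → ∀ m b → p ∤ m → ¬ (+ p ∣ℤ b) → ¬ (+ p ∣ℤ (+ m * b))
prime∤*ℤ {p} pp m b p∤m p∤b p∣mb
  with euclidsLemma m ∣ b ∣ pp (subst (p ∣_) (abs-* (+ m) b) p∣mb)
... | inj₁ p∣m = p∤m p∣m
... | inj₂ p∣b = p∤b p∣b

∣ℤ-neg⁻ : ∀ {p} i → + p ∣ℤ (- i) → + p ∣ℤ i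
∣ℤ-neg⁻ {p} i = subst (p ∣_) (∣-i∣≡∣i∣ i)

∣ℤ⇒≡0[modℕ] : ∀ {p} i → + p ∣ℤ i → i ≡ + 0 [modℕ p ]
∣ℤ⇒≡0[modℕ] {p} i = subst (+ p ∣ℤ_) (sym (+-identityʳ i))

proposition4p4 : ∀ {c r p : Level} (ℓ : ℕ) → Prime ℓ →
    (G : AbelianGroup c r) → IsFinite G →
    let open AbelianGroup G in
    (S : Carrier → Set p) →
    (∀ {x y} → x ≈ y → S x → S y) →
    Generates G S →
    (∀ s → S s → S (s ⁻¹)) →
    ¬ S ε →
    (β : Carrier → ℤ) →
    (∀ {x y} → S x → x ≈ y → β x ≡ β y) →
    ImageGeneratesℤℓ S β ℓ →
    (∀ s → S s → β (s ⁻¹) ≡ Data.Integer.- β s) →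
    (∃ λ h → Σ ℕ λ M → S h × HasOrder G h M × 1 < M × gcd M ℓ ≡ 1 × ¬ (β h ≡ Data.Integer.+ 0 [modℕ ℓ ])) →
    ∃ λ (m : ℕ) → 0 < m × Σ (Vec Carrier m) λ hs →
    All S hs × S (prodV G hs) × ¬ (β (prodV G hs) ≡ sumβ β hs [modℕ ℓ ])
proposition4p4 _ _ _ _ _ _ _ _ _ _ _ _ _ (_ , suc zero , _ , _ , s≤s () , _)
proposition4p4 ℓ pℓ G _ S S-resp _ S-inv _ β β-resp _ β-inv
  (h , M@(suc (suc n)) , Sh , (_ , hᴹ≈ε , _) , _ , gcd≡1 , ℓ∤βh) =
  suc n , s≤s z≤n , hs , All-replicate (suc n) Sh , S-prod , defect≢0
  where
  open AbelianGroup G using (Carrier; _≈_; _⁻¹) renaming (sym to ≈-sym)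

  hs : Vec Carrier (suc n)
  hs = replicate (suc n) h

  prod≈h⁻¹ : prodV G hs ≈ h ⁻¹
  prod≈h⁻¹ = prodV-replicate≈⁻¹ G h (suc n) hᴹ≈ε

  S-prod : S (prodV G hs)
  S-prod = S-resp (≈-sym prod≈h⁻¹) (S-inv h Sh)

  defect≡ : β (prodV G hs) - sumβ β hs ≡ - (+ M * β h)
  defect≡ = begin
    β (prodV G hs) - sumβ β hs ≡⟨ cong (_- sumβ β hs) (β-resp S-prod prod≈h⁻¹) ⟩
    β (h ⁻¹) - sumβ β hs       ≡⟨ cong₂ _-_ (β-inv h Sh) (sumβ-replicate β (suc n) h) ⟩
    - β h - + suc n * β h      ≡⟨ neg-sub-*≡neg-suc-* (suc n) (β h) ⟩
    - (+ M * β h)              ∎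
    where open ≡-Reasoning

  defect≢0 : ¬ (β (prodV G hs) ≡ sumβ β hs [modℕ ℓ ])
  defect≢0 ℓ∣defect =
    prime∤*ℤ pℓ M (β h) (gcd≡1∧prime⇒∤ M pℓ gcd≡1) (ℓ∤βh ∘ ∣ℤ⇒≡0[modℕ] (β h))
      (∣ℤ-neg⁻ (+ M * β h) (subst (+ ℓ ∣ℤ_) defect≡ ℓ∣defect))
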